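{- Let $\Delta$ be a pure simplicial complex and $v$ a vertex of $\Delta$. Then every facet of $\mathrm{del}_\Delta(v)$ is a facet of $\Delta$ (i.e. $v$ is a shedding vertex) if and only if every facet of $\mathrm{st}_\Delta(v)$ is adjacent to some facet of $\mathrm{del}_\Delta(v)$.
   Context: A simplicial complex on ground set $V$ is a family of subsets closed under subsets; facets are maximal faces; pure means all facets have equal cardinality, say $d+1$. $\mathrm{st}_\Delta(v)=\{G\in\Delta: v\in G\}$ (its facets are its inclusion-maximal members), $\mathrm{del}_\Delta(v)=\{G\in\Delta: v\notin G\}$. Two $(d+1)$-sets $F,G$ are adjacent if $|F\cap G|=d$. -}

module Defs where

open import Data.Nat using (ℕ; suc)
open import Data.Fin using (Fin)
open import Data.Fin.Subset using (Subset; _∈_; _∉_; _⊆_; _∩_; ∣_∣; ⁅_⁆)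
open import Data.Product using (_×_)
open import Relation.Binary.PropositionalEquality using (_≡_)
open import Relation.Nullary using (Dec)

record SimplicialComplex (n : ℕ) : Set₁ where
  field
    face      : Subset n → Set
    face?     : (F : Subset n) → Dec (face F)
    downClosed : ∀ {F G} → G ⊆ F → face F → face G
open SimplicialComplex public

IsMaximal : ∀ {n} → (Subset n → Set) → Subset n → Set
IsMaximal P F = P F × (∀ G → P G → F ⊆ G → G ≡ F)

IsFacet : ∀ {n} → SimplicialComplex n → Subset n → Set
IsFacet Δ = IsMaximal (face Δ)

IsPure : ∀ {n} → SimplicialComplex n → ℕ → Set
IsPure Δ d = ∀ F → IsFacet Δ F → ∣ F ∣ ≡ suc d

IsVertex : ∀ {n} → SimplicialComplex n → Fin n → Set
IsVertex Δ v = face Δ ⁅ v ⁆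

star : ∀ {n} → SimplicialComplex n → Fin n → Subset n → Set
star Δ v G = face Δ G × v ∈ G

deletion : ∀ {n} → SimplicialComplex n → Fin n → Subset n → Set
deletion Δ v G = face Δ G × v ∉ G

Adjacent : ∀ {n} → ℕ → Subset n → Subset n → Set
Adjacent d F G = ∣ F ∣ ≡ suc d × ∣ G ∣ ≡ suc d × ∣ F ∩ G ∣ ≡ d

-- A facet F of the star is a facet of Δ, and F - v lies in the deletion. If v is a shedding
-- vertex, any facet G of the deletion above F - v is a (d+1)-set with F ∩ G = F - v, a d-set.
-- Conversely, if some facet G of the deletion lies in a face containing v, extend that face to
-- a facet F of the star; maximality of G forces F - v = G, so G has d elements, while an
-- adjacent deletion facet G' satisfies F ∩ G' ⊆ F - v = G with |F ∩ G'| = d, hence G ⊆ G',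
-- hence G' = G, contradicting |G'| = d + 1.
module Submission where

open import Defs
open import Data.Nat using (ℕ; zero; suc; _+_; _≤_)
open import Data.Nat.Properties
  using (≤-trans; ≤-reflexive; <⇒≱; <-≤-trans; m≤m+n; +-suc; +-monoʳ-≤; suc-injective; 1+n≢n)
open import Data.Fin using (Fin; zero; suc)
open import Data.Fin.Subset
  using (Subset; inside; outside; _∈_; _∉_; _⊆_; _⊂_; _∩_; _-_; ∣_∣)
open import Data.Fin.Subset.Properties
  using (_∈?_; _⊂?_; anySubset?; ⊆-refl; ⊆-trans; ⊆-antisym; ∣p∣≤n; p⊂q⇒∣p∣<∣q∣;
         x∈p∩q⁺; x∈p∩q⁻; p∩q⊆q; p─q⊆p; p─⊥≡p; x∈p∧x≢y⇒x∈p-y)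
open import Data.Vec using (_∷_; here; there)
open import Data.Product using (Σ; ∃; _×_; _,_; proj₂)
open import Data.Sum using (_⊎_; inj₁; inj₂)
open import Data.Empty using (⊥-elim)
open import Function.Bundles using (_⇔_; mk⇔)
open import Relation.Nullary using (Dec; yes; no; ¬_)
open import Relation.Nullary.Negation using (contradiction)
open import Relation.Nullary.Decidable using (_×-dec_; ¬?)
open import Relation.Binary.PropositionalEquality using (_≡_; refl; sym; trans; cong; subst)

x∉p-x : ∀ {n} (p : Subset n) x → x ∉ p - x
x∉p-x (s ∷ p) zero      ()
x∉p-x (s ∷ p) (suc x) (there x∈p-x) = x∉p-x p x x∈p-x

x∈p⇒∣p∣≡1+∣p-x∣ : ∀ {n} {p : Subset n} {x} → x ∈ p → ∣ p ∣ ≡ suc ∣ p - x ∣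
x∈p⇒∣p∣≡1+∣p-x∣ {p = inside ∷ p}  {zero}  here       = cong suc (cong ∣_∣ (sym (p─⊥≡p p)))
x∈p⇒∣p∣≡1+∣p-x∣ {p = inside ∷ p}  {suc x} (there x∈p) = cong suc (x∈p⇒∣p∣≡1+∣p-x∣ x∈p)
x∈p⇒∣p∣≡1+∣p-x∣ {p = outside ∷ p} {suc x} (there x∈p) = x∈p⇒∣p∣≡1+∣p-x∣ x∈p

x∉q⇒p∩q⊆p-x : ∀ {n} {p q : Subset n} {x} → x ∉ q → p ∩ q ⊆ p - x
x∉q⇒p∩q⊆p-x {p = p} {q} x∉q y∈p∩q with x∈p∩q⁻ p q y∈p∩q
... | y∈p , y∈q = x∈p∧x≢y⇒x∈p-y y∈p (λ { refl → x∉q y∈q })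

p⊆q∧∣q∣≤∣p∣⇒p≡q : ∀ {n} {p q : Subset n} → p ⊆ q → ∣ q ∣ ≤ ∣ p ∣ → p ≡ q
p⊆q∧∣q∣≤∣p∣⇒p≡q {p = p} {q} p⊆q ∣q∣≤∣p∣ = ⊆-antisym p⊆q q⊆p
  where
  q⊆p : q ⊆ p
  q⊆p {x} x∈q with x ∈? p
  ... | yes x∈p = x∈p
  ... | no  x∉p = contradiction ∣q∣≤∣p∣ (<⇒≱ (p⊂q⇒∣p∣<∣q∣ (p⊆q , x , x∈q , x∉p)))

module _ {n} {P : Subset n → Set} (P? : ∀ F → Dec (P F)) where

  maximal⊎⊂ : ∀ {F} → P F → IsMaximal P F ⊎ ∃ λ G → P G × F ⊂ G
  maximal⊎⊂ {F} pF with anySubset? (λ G → P? G ×-dec (F ⊂? G))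
  ... | yes larger = inj₂ larger
  ... | no  ∄larger = inj₁ (pF , λ G pG F⊆G → ⊆-antisym (G⊆F pG F⊆G) F⊆G)
    where
    G⊆F : ∀ {G} → P G → F ⊆ G → G ⊆ F
    G⊆F {G} pG F⊆G {x} x∈G with x ∈? F
    ... | yes x∈F = x∈F
    ... | no  x∉F = contradiction (G , pG , (λ {y} → F⊆G {y}) , x , x∈G , x∉F) ∄larger

  extendToMaximal : ∀ k F → n ≤ k + ∣ F ∣ → P F → ∃ λ G → F ⊆ G × IsMaximal P G
  extendToMaximal k F bound pF with maximal⊎⊂ pF
  ... | inj₁ maxF = F , ⊆-refl , maxF
  extendToMaximal zero F bound pF | inj₂ (G , _ , F⊂G) =
    contradiction bound (<⇒≱ (<-≤-trans (p⊂q⇒∣p∣<∣q∣ F⊂G) (∣p∣≤n G)))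
  extendToMaximal (suc k) F bound pF | inj₂ (G , pG , F⊂G@(F⊆G , _))
    with extendToMaximal k G (≤-trans bound (≤-trans (≤-reflexive (sym (+-suc k ∣ F ∣)))
                                                    (+-monoʳ-≤ k (p⊂q⇒∣p∣<∣q∣ F⊂G)))) pG
  ... | H , G⊆H , maxH = H , ⊆-trans F⊆G G⊆H , maxH

  maximalExtension : ∀ F → P F → ∃ λ G → F ⊆ G × IsMaximal P G
  maximalExtension F = extendToMaximal n F (m≤m+n n ∣ F ∣)

module _ {n} (Δ : SimplicialComplex n) (v : Fin n) where

  star? : ∀ F → Dec (star Δ v F)
  star? F = face? Δ F ×-dec (v ∈? F)

  deletion? : ∀ F → Dec (deletion Δ v F)
  deletion? F = face? Δ F ×-dec ¬? (v ∈? F)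

  star-maximal⇒facet : ∀ {F} → IsMaximal (star Δ v) F → IsFacet Δ F
  star-maximal⇒facet ((ΔF , v∈F) , maxF) =
    ΔF , λ G ΔG F⊆G → maxF G (ΔG , F⊆G v∈F) F⊆G

  face-v∈deletion : ∀ {F} → face Δ F → deletion Δ v (F - v)
  face-v∈deletion {F} ΔF = downClosed Δ (p─q⊆p F _) ΔF , x∉p-x F v

  maxDeletion⊆star⇒star-v≡ : ∀ {F G} → IsMaximal (deletion Δ v) G → star Δ v F → G ⊆ F →
                             F - v ≡ G
  maxDeletion⊆star⇒star-v≡ {F} ((_ , v∉G) , maxG) (ΔF , _) G⊆F =
    maxG (F - v) (face-v∈deletion ΔF)
         (λ x∈G → x∈p∧x≢y⇒x∈p-y (G⊆F x∈G) (λ { refl → v∉G x∈G }))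

∣p∣≡1+k⇒∣p-x∣≡k : ∀ {n} {p : Subset n} {x k} → x ∈ p → ∣ p ∣ ≡ suc k → ∣ p - x ∣ ≡ k
∣p∣≡1+k⇒∣p-x∣≡k x∈p ∣p∣≡1+k = suc-injective (trans (sym (x∈p⇒∣p∣≡1+∣p-x∣ x∈p)) ∣p∣≡1+k)

module _ {n} (Δ : SimplicialComplex n) (d : ℕ) (v : Fin n) where

  IsSheddingVertex : Set
  IsSheddingVertex = ∀ G → IsMaximal (deletion Δ v) G → IsFacet Δ G

  StarFacetsAdjacentToDeletion : Set
  StarFacetsAdjacentToDeletion =
    ∀ F → IsMaximal (star Δ v) F → Σ (Subset n) (λ G → IsMaximal (deletion Δ v) G × Adjacent d F G)

  shedding⇒starFacetsAdjacent : IsPure Δ d → IsSheddingVertex → StarFacetsAdjacentToDeletion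
  shedding⇒starFacetsAdjacent pure shedding F maxF@((ΔF , v∈F) , _)
    with maximalExtension (deletion? Δ v) (F - v) (face-v∈deletion Δ v ΔF)
  ... | G , F-v⊆G , maxG@((_ , v∉G) , _) =
    G , maxG , ∣F∣≡1+d , pure G (shedding G maxG) , trans (cong ∣_∣ F∩G≡F-v) (∣p∣≡1+k⇒∣p-x∣≡k v∈F ∣F∣≡1+d)
    where
    ∣F∣≡1+d : ∣ F ∣ ≡ suc d
    ∣F∣≡1+d = pure F (star-maximal⇒facet Δ v maxF)

    F∩G≡F-v : F ∩ G ≡ F - v
    F∩G≡F-v = ⊆-antisym (x∉q⇒p∩q⊆p-x v∉G) (λ x∈F-v → x∈p∩q⁺ (p─q⊆p F _ x∈F-v , F-v⊆G x∈F-v))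

  starFacetsAdjacent⇒maxDeletion⊈star : StarFacetsAdjacentToDeletion →
    ∀ {G H} → IsMaximal (deletion Δ v) G → star Δ v H → ¬ (G ⊆ H)
  starFacetsAdjacent⇒maxDeletion⊈star adjacent {G} maxG sH G⊆H
    with maximalExtension (star? Δ v) _ sH
  ... | F , H⊆F , maxF@(sF , _) with adjacent F maxF
  ... | G' , ((delG'@(_ , v∉G') , _) , ∣F∣≡1+d , ∣G'∣≡1+d , ∣F∩G'∣≡d) =
    1+n≢n (trans (sym ∣G'∣≡1+d) (trans (cong ∣_∣ G'≡G) ∣G∣≡d))
    where
    F-v≡G : F - v ≡ G
    F-v≡G = maxDeletion⊆star⇒star-v≡ Δ v maxG sF (⊆-trans G⊆H H⊆F)

    ∣G∣≡d : ∣ G ∣ ≡ d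
    ∣G∣≡d = subst (λ X → ∣ X ∣ ≡ d) F-v≡G (∣p∣≡1+k⇒∣p-x∣≡k (proj₂ sF) ∣F∣≡1+d)

    F∩G'≡G : F ∩ G' ≡ G
    F∩G'≡G = p⊆q∧∣q∣≤∣p∣⇒p≡q (subst (F ∩ G' ⊆_) F-v≡G (x∉q⇒p∩q⊆p-x v∉G'))
                             (≤-reflexive (trans ∣G∣≡d (sym ∣F∩G'∣≡d)))

    G'≡G : G' ≡ G
    G'≡G = proj₂ maxG G' delG' (subst (_⊆ G') F∩G'≡G (p∩q⊆q F G'))

  starFacetsAdjacent⇒shedding : StarFacetsAdjacentToDeletion → IsSheddingVertex
  starFacetsAdjacent⇒shedding adjacent G maxG@((ΔG , v∉G) , maxDelG) = ΔG , G-maximal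
    where
    G-maximal : ∀ H → face Δ H → G ⊆ H → H ≡ G
    G-maximal H ΔH G⊆H with v ∈? H
    ... | no  v∉H = maxDelG H (ΔH , v∉H) G⊆H
    ... | yes v∈H = ⊥-elim (starFacetsAdjacent⇒maxDeletion⊈star adjacent maxG (ΔH , v∈H) G⊆H)

lemma2p6 : ∀ {n} (Δ : SimplicialComplex n) (d : ℕ) (v : Fin n) →
    IsPure Δ d → IsVertex Δ v →
    ((∀ F → IsMaximal (deletion Δ v) F → IsFacet Δ F) ⇔
     (∀ F → IsMaximal (star Δ v) F →
        Σ (Subset n) (λ G → IsMaximal (deletion Δ v) G × Adjacent d F G)))
lemma2p6 Δ d v pure _ =
  mk⇔ (shedding⇒starFacetsAdjacent Δ d v pure) (starFacetsAdjacent⇒shedding Δ d v)
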